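{- Let $t$ be a proof term of $\mathsf{LC}^\star$ in head normal form, and suppose $t=t_1\parallel_{a_1}t_2\parallel_{a_2}\cdots\parallel_{a_n}t_{n+1}$ (parentheses omitted) where each $t_i$ is an elementary process. Then for every $1\le i\le n+1$ there is a stack $\sigma$ such that one of the following holds: $t_i=x\,\sigma$ for a proof variable $x\neq a_1,\dots,a_n$; or $t_i=\mathcal A\,u\,\sigma$ for an abort constant $\mathcal A$, with the type of $u$ different from the type of $\mathcal A\,u\,\sigma$; or $t_i=a_j$ for some $j$; or $t_i$ is a value.
   Context: Formulas. Terms of the first-order language $\mathcal{L}$ are individual variables $\alpha,\beta,\dots$, constants, and $f(m_1,\dots,m_n)$ for function symbols $f$. Atomic formulas are $P(m_1,\dots,m_n)$ for predicate symbols $P$, including a $0$-ary symbol $\bot$; formulas are built from atomic ones with $\wedge,\vee,\to,\forall\alpha,\exists\alpha$. Proof terms of $\mathsf{LC}$ and typing (Church style; every proof variable $x^A$ carries its type; terms up to renaming of bound variables). $x^A:A$. If $u:A$, $t:B$ then $\langle u,t\rangle:A\wedge B$; if $u:A\wedge B$ then $u\pi_0:A$, $u\pi_1:B$. If $t:A\to B$, $u:A$ then $tu:B$; if $u:B$ then $\lambda x^A u:A\to B$. If $u:A$ then $\iota_0(u):A\vee B$; if $u:B$ then $\iota_1(u):A\vee B$; if $u:A\vee B$, $w_1:C$, $w_2:C$ then $u[x^A.w_1,y^B.w_2]:C$. If $u:\forall\alpha A$ and $m\in\mathcal L$ then $um:A[m/\alpha]$; if $u:A$ and $\alpha$ is not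 free in the type of any free proof variable of $u$ then $\lambda\alpha u:\forall\alpha A$. If $u:A[m/\alpha]$ then $(m,u):\exists\alpha A$; if $u:\exists\alpha A$ and $t:C$ with $\alpha$ not free in $C$ nor in the type of any free proof variable of $t$ other than $x^A$, then $u[(\alpha,x^A).t]:C$. Dummett rule: if $u:C$ and $v:C$, where $a$ occurs in $u$ with type $A\to B$ and in $v$ with type $B\to A$, then $u\parallel_a v:C$, binding $a$. If $u:\bot$ and $P$ atomic then $\mathsf{efq}_P(u):P$. The system $\mathsf{LC}^\star$ adds, for all formulas $A,B$, a constant $\mathcal A^{A\to B}:A\to B$ (abort). Stacks: finite sequences $\sigma=\sigma_1\cdot\ldots\cdot\sigma_n$ of components each a proof term, a term of $\mathcal L$, $\pi_0$, $\pi_1$, $[x.u,y.v]$ or $[(\alpha,x).v]$; $\epsilon$ empty; $t\sigma=((t\sigma_1)\sigma_2)\ldots\sigma_n$. Parallel context $\mathcal C[\,]$: $u_1\parallel_{a_1}\cdots u_i\parallel_{a_i}[\,]\parallel_{a_{i+1}}u_{i+1}\cdots\parallel_{a_n}u_n$ with hole $[\,]$. Basic reductions $\mapsto$: $(\lambda x u)t\mapsto u[t/x]$; $(\lambda\alpha u)m\mapsto u[m/\alpha]$; $\langle u_0,u_1\rangle\pi_i\mapsto u_i$; $\iota_i(u)[x_0.t_0,x_1.t_1]\mapsto t_i[u/x_i]$; $(m,u)[(\alpha,x).v]\mapsto v[m/\alpha][u/x]$; $(u\parallel_a v)w\mapsto uw\parallel_a vw$ ($a$ not free in $w$); $(u\parallel_a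 v)\pi_i\mapsto u\pi_i\parallel_a v\pi_i$; $(u\parallel_a v)[x.w_1,y.w_2]\mapsto u[x.w_1,y.w_2]\parallel_a v[x.w_1,y.w_2]$; $(u\parallel_a v)[(\alpha,x).w]\mapsto u[(\alpha,x).w]\parallel_a v[(\alpha,x).w]$ ($a$ not free in the $w$'s); $\mathcal C[a^{A\to B}u\sigma]\parallel_a v\mapsto\mathcal C[v[\lambda y^B u/a^{B\to A}]]\parallel_a v$ and $v\parallel_a\mathcal C[a^{A\to B}u\sigma]\mapsto v\parallel_a\mathcal C[v[\lambda y^B u/a^{B\to A}]]$ ($\mathcal C$ parallel context, $a$ free in $\mathcal C[au\sigma]$, $y$ dummy); and in $\mathsf{LC}^\star$: $\mathcal A\,u\,\sigma\mapsto u$ whenever $\mathcal A u\sigma$ and $u$ have the same type. Head reduction. Writing $t$ as $t_1\parallel_{a_1}\cdots\parallel_{a_n}t_{n+1}$ (parentheses omitted), each $t_i$ is a parallel process; elementary if not of the form $u\parallel_a v$. A redex is a term $r$ with $r\mapsto r'$ for some $r'$. For stacks $\sigma$ and $\xi$ of length one, the head redex of $t$ is: $(\lambda xu)v$ if $t=(\lambda xu)v\sigma$; $(\lambda\alpha u)m$ if $t=(\lambda\alpha u)m\sigma$; $\langle u,v\rangle\pi_i$ if $t=\langle u,v\rangle\pi_i\sigma$; $\iota_i(u)[\ldots]$ if $t=\iota_i(u)[\ldots]\sigma$; $(m,u)[(\alpha,x).v]$ if $t=(m,u)[(\alpha,x).v]\sigma$; $(u\parallel_a v)\xi$ if $t=(u\parallel_a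 v)\xi\sigma$; $t$ if $t=u\parallel_a v$; $\mathcal Au\sigma$ if $t=\mathcal Au\sigma$ and $u$, $\mathcal Au\sigma$ have the same type — each provided the indicated subterm is a redex. The starting symbol of a redex $r$ is its opening parenthesis if $r=(u\xi)$ and, if $r=u\parallel_a v$, the leftmost occurrence of $a$ such that $a\,s\,\rho$ is an elementary process of $r$. $t\succ t'$ iff $t'$ results from contracting the head redex whose starting symbol is leftmost among the head redexes of the parallel processes of $t$. $t$ is in head normal form if there is no $t'$ with $t\succ t'$. Values: terms of the form $\lambda x\,u$, $\lambda\alpha\,u$, $\langle u,t\rangle$, $\iota_i(u)$, $(m,u)$, $\mathsf{efq}_P(u)$, or an abort constant $\mathcal A$. -}

module Defs where

-- Bound variables (both individual and proof variables) are represented by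
-- de Bruijn indices, which realises "terms up to renaming of bound variables".

open import Data.Nat using (ℕ; zero; suc; _+_; _<_; _≤_)
open import Data.List using (List; []; _∷_)
open import Data.Maybe using (Maybe; just; nothing; _>>=_)
import Data.Maybe as M
open import Data.Sum using (_⊎_; inj₁; inj₂; [_,_]; map₁)
open import Data.Product using (_×_; ∃; ∃-syntax; _,_)
open import Data.Unit using (⊤)
open import Data.Empty using (⊥)
open import Relation.Binary.PropositionalEquality using (_≡_)
open import Relation.Nullary using (¬_)
open import Function using (id)

data Tm : Set where
  tv  : ℕ → Tm
  cst : ℕ → Tm
  fn  : ℕ → List Tm → Tm

infixr 6 _∧f_
infixr 5 _∨f_
infixr 4 _⇒_

data Fm : Set where
  atom : ℕ → List Tm → Fm
  ⊥f   : Fm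
  _∧f_ : Fm → Fm → Fm
  _∨f_ : Fm → Fm → Fm
  _⇒_  : Fm → Fm → Fm
  ∀f   : Fm → Fm
  ∃f   : Fm → Fm

data Atomic : Fm → Set where
  atomA : ∀ P ms → Atomic (atom P ms)
  botA  : Atomic ⊥f

mutual
  substT : (ℕ → Tm) → Tm → Tm
  substT σ (tv i)    = σ i
  substT σ (cst c)   = cst c
  substT σ (fn f ms) = fn f (substTs σ ms)

  substTs : (ℕ → Tm) → List Tm → List Tm
  substTs σ []       = []
  substTs σ (m ∷ ms) = substT σ m ∷ substTs σ ms

shiftσ : ℕ → Tm
shiftσ i = tv (suc i)

extsT : (ℕ → Tm) → ℕ → Tm
extsT σ zero    = tv zero
extsT σ (suc i) = substT shiftσ (σ i)

substF : (ℕ → Tm) → Fm → Fm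
substF σ (atom P ms) = atom P (substTs σ ms)
substF σ ⊥f          = ⊥f
substF σ (A ∧f B)    = substF σ A ∧f substF σ B
substF σ (A ∨f B)    = substF σ A ∨f substF σ B
substF σ (A ⇒ B)     = substF σ A ⇒ substF σ B
substF σ (∀f A)      = ∀f (substF (extsT σ) A)
substF σ (∃f A)      = ∃f (substF (extsT σ) A)

shiftF : Fm → Fm
shiftF = substF shiftσ

inst : Tm → ℕ → Tm
inst m zero    = m
inst m (suc i) = tv i

_[_]F : Fm → Tm → Fm
A [ m ]F = substF (inst m) A

lowerV : ℕ → ℕ → Maybe ℕ
lowerV zero    zero    = nothing
lowerV zero    (suc i) = just i
lowerV (suc c) zero    = just zero
lowerV (suc c) (suc i) = M.map suc (lowerV c i)

mutual
  lowerT : ℕ → Tm → Maybe Tm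
  lowerT c (tv i)    = M.map tv (lowerV c i)
  lowerT c (cst k)   = just (cst k)
  lowerT c (fn f ms) = M.map (fn f) (lowerTs c ms)

  lowerTs : ℕ → List Tm → Maybe (List Tm)
  lowerTs c []       = just []
  lowerTs c (m ∷ ms) = lowerT c m >>= λ m′ → M.map (m′ ∷_) (lowerTs c ms)

lowerF : ℕ → Fm → Maybe Fm
lowerF c (atom P ms) = M.map (atom P) (lowerTs c ms)
lowerF c ⊥f          = just ⊥f
lowerF c (A ∧f B)    = lowerF c A >>= λ A′ → M.map (A′ ∧f_) (lowerF c B)
lowerF c (A ∨f B)    = lowerF c A >>= λ A′ → M.map (A′ ∨f_) (lowerF c B)
lowerF c (A ⇒ B)     = lowerF c A >>= λ A′ → M.map (A′ ⇒_) (lowerF c B)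
lowerF c (∀f A)      = M.map ∀f (lowerF (suc c) A)
lowerF c (∃f A)      = M.map ∃f (lowerF (suc c) A)

-- Proof terms of LC* (Church style).  Proof variables are de Bruijn indices
-- and every occurrence carries its type.

data Pf : Set where
  pv     : ℕ → Fm → Pf
  ⟨_,_⟩  : Pf → Pf → Pf
  π₀     : Pf → Pf
  π₁     : Pf → Pf
  _·_    : Pf → Pf → Pf
  ƛ      : Fm → Pf → Pf
  ι₀     : Fm → Fm → Pf → Pf
  ι₁     : Fm → Fm → Pf → Pf
  case   : Pf → Fm → Pf → Fm → Pf → Pf
  _·ₜ_   : Pf → Tm → Pf
  Λ      : Pf → Pf
  pack   : Tm → Fm → Pf → Pf
  unpack : Pf → Fm → Pf → Pf            -- u[(α,x^A).t]  (binds α and x)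
  par    : Fm → Fm → Pf → Pf → Pf
  efq    : Fm → Pf → Pf
  abort  : Fm → Fm → Pf

-- Typing.  Γ lists the types of the free proof variables (index 0 first).
data _∋_∶_ : List Fm → ℕ → Fm → Set where
  here  : ∀ {Γ A} → (A ∷ Γ) ∋ zero ∶ A
  there : ∀ {Γ A B i} → Γ ∋ i ∶ A → (B ∷ Γ) ∋ suc i ∶ A

shiftCtx : List Fm → List Fm
shiftCtx = Data.List.map shiftF

infix 3 _⊢_∶_
data _⊢_∶_ : List Fm → Pf → Fm → Set where
  ⊢var    : ∀ {Γ i A} → Γ ∋ i ∶ A → Γ ⊢ pv i A ∶ A
  ⊢pair   : ∀ {Γ u t A B} → Γ ⊢ u ∶ A → Γ ⊢ t ∶ B → Γ ⊢ ⟨ u , t ⟩ ∶ A ∧f B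
  ⊢π₀     : ∀ {Γ u A B} → Γ ⊢ u ∶ A ∧f B → Γ ⊢ π₀ u ∶ A
  ⊢π₁     : ∀ {Γ u A B} → Γ ⊢ u ∶ A ∧f B → Γ ⊢ π₁ u ∶ B
  ⊢app    : ∀ {Γ t u A B} → Γ ⊢ t ∶ A ⇒ B → Γ ⊢ u ∶ A → Γ ⊢ t · u ∶ B
  ⊢lam    : ∀ {Γ u A B} → (A ∷ Γ) ⊢ u ∶ B → Γ ⊢ ƛ A u ∶ A ⇒ B
  ⊢inj₀   : ∀ {Γ u A B} → Γ ⊢ u ∶ A → Γ ⊢ ι₀ A B u ∶ A ∨f B
  ⊢inj₁   : ∀ {Γ u A B} → Γ ⊢ u ∶ B → Γ ⊢ ι₁ A B u ∶ A ∨f B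
  ⊢case   : ∀ {Γ u w₁ w₂ A B C} → Γ ⊢ u ∶ A ∨f B → (A ∷ Γ) ⊢ w₁ ∶ C →
            (B ∷ Γ) ⊢ w₂ ∶ C → Γ ⊢ case u A w₁ B w₂ ∶ C
  ⊢appT   : ∀ {Γ u A} (m : Tm) → Γ ⊢ u ∶ ∀f A → Γ ⊢ u ·ₜ m ∶ A [ m ]F
  -- eigenvariable condition: α (index 0) does not occur in Γ
  ⊢lamT   : ∀ {Γ u A} → shiftCtx Γ ⊢ u ∶ A → Γ ⊢ Λ u ∶ ∀f A
  ⊢pack   : ∀ {Γ u A} (m : Tm) → Γ ⊢ u ∶ A [ m ]F → Γ ⊢ pack m A u ∶ ∃f A
  -- eigenvariable condition: α not free in C nor in Γ
  ⊢unpack : ∀ {Γ u t A C} → Γ ⊢ u ∶ ∃f A → (A ∷ shiftCtx Γ) ⊢ t ∶ shiftF C →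
            Γ ⊢ unpack u A t ∶ C
  ⊢par    : ∀ {Γ u v A B C} → ((A ⇒ B) ∷ Γ) ⊢ u ∶ C → ((B ⇒ A) ∷ Γ) ⊢ v ∶ C →
            Γ ⊢ par A B u v ∶ C
  ⊢efq    : ∀ {Γ u P} → Atomic P → Γ ⊢ u ∶ ⊥f → Γ ⊢ efq P u ∶ P
  ⊢abort  : ∀ {Γ A B} → Γ ⊢ abort A B ∶ A ⇒ B

fstF : Fm → Maybe Fm
fstF (A ∧f B) = just A
fstF _        = nothing

sndF : Fm → Maybe Fm
sndF (A ∧f B) = just B
sndF _        = nothing

codF : Fm → Maybe Fm
codF (A ⇒ B) = just B
codF _       = nothing

allF : Tm → Fm → Maybe Fm
allF m (∀f A) = just (A [ m ]F)
allF m _      = nothing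

typeOf : Pf → Maybe Fm
typeOf (pv i A)           = just A
typeOf ⟨ u , t ⟩          = typeOf u >>= λ A → M.map (A ∧f_) (typeOf t)
typeOf (π₀ u)             = typeOf u >>= fstF
typeOf (π₁ u)             = typeOf u >>= sndF
typeOf (t · u)            = typeOf t >>= codF
typeOf (ƛ A u)            = M.map (A ⇒_) (typeOf u)
typeOf (ι₀ A B u)         = just (A ∨f B)
typeOf (ι₁ A B u)         = just (A ∨f B)
typeOf (case u A w₁ B w₂) = typeOf w₁
typeOf (u ·ₜ m)           = typeOf u >>= allF m
typeOf (Λ u)              = M.map ∀f (typeOf u)
typeOf (pack m A u)       = just (∃f A)
typeOf (unpack u A t)     = typeOf t >>= lowerF zero
typeOf (par A B u v)      = typeOf u
typeOf (efq P u)          = just P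
typeOf (abort A B)        = just (A ⇒ B)

substPT : (ℕ → Tm) → Pf → Pf
substPT σ (pv i A)           = pv i (substF σ A)
substPT σ ⟨ u , t ⟩          = ⟨ substPT σ u , substPT σ t ⟩
substPT σ (π₀ u)             = π₀ (substPT σ u)
substPT σ (π₁ u)             = π₁ (substPT σ u)
substPT σ (t · u)            = substPT σ t · substPT σ u
substPT σ (ƛ A u)            = ƛ (substF σ A) (substPT σ u)
substPT σ (ι₀ A B u)         = ι₀ (substF σ A) (substF σ B) (substPT σ u)
substPT σ (ι₁ A B u)         = ι₁ (substF σ A) (substF σ B) (substPT σ u)
substPT σ (case u A w₁ B w₂) =
  case (substPT σ u) (substF σ A) (substPT σ w₁) (substF σ B) (substPT σ w₂)
substPT σ (u ·ₜ m)           = substPT σ u ·ₜ substT σ m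
substPT σ (Λ u)              = Λ (substPT (extsT σ) u)
substPT σ (pack m A u)       = pack (substT σ m) (substF (extsT σ) A) (substPT σ u)
substPT σ (unpack u A t)     =
  unpack (substPT σ u) (substF (extsT σ) A) (substPT (extsT σ) t)
substPT σ (par A B u v)      = par (substF σ A) (substF σ B) (substPT σ u) (substPT σ v)
substPT σ (efq P u)          = efq (substF σ P) (substPT σ u)
substPT σ (abort A B)        = abort (substF σ A) (substF σ B)

extR : (ℕ → ℕ) → ℕ → ℕ
extR f zero    = zero
extR f (suc i) = suc (f i)

renP : (ℕ → ℕ) → Pf → Pf
renP f (pv i A)           = pv (f i) A
renP f ⟨ u , t ⟩          = ⟨ renP f u , renP f t ⟩
renP f (π₀ u)             = π₀ (renP f u)
renP f (π₁ u)             = π₁ (renP f u)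
renP f (t · u)            = renP f t · renP f u
renP f (ƛ A u)            = ƛ A (renP (extR f) u)
renP f (ι₀ A B u)         = ι₀ A B (renP f u)
renP f (ι₁ A B u)         = ι₁ A B (renP f u)
renP f (case u A w₁ B w₂) = case (renP f u) A (renP (extR f) w₁) B (renP (extR f) w₂)
renP f (u ·ₜ m)           = renP f u ·ₜ m
renP f (Λ u)              = Λ (renP f u)
renP f (pack m A u)       = pack m A (renP f u)
renP f (unpack u A t)     = unpack (renP f u) A (renP (extR f) t)
renP f (par A B u v)      = par A B (renP (extR f) u) (renP (extR f) v)
renP f (efq P u)          = efq P (renP f u)
renP f (abort A B)        = abort A B

-- simultaneous substitution of proof variables: each index is sent either to
-- a proof term (inj₁) or renamed to another variable keeping its type (inj₂)
PSub : Set
PSub = ℕ → Pf ⊎ ℕ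

extP : PSub → PSub
extP ρ zero    = inj₂ zero
extP ρ (suc i) = [ (λ p → inj₁ (renP suc p)) , (λ j → inj₂ (suc j)) ] (ρ i)

extPT : PSub → PSub
extPT ρ i = map₁ (substPT shiftσ) (ρ i)

substP : PSub → Pf → Pf
substP ρ (pv i A)           = [ id , (λ j → pv j A) ] (ρ i)
substP ρ ⟨ u , t ⟩          = ⟨ substP ρ u , substP ρ t ⟩
substP ρ (π₀ u)             = π₀ (substP ρ u)
substP ρ (π₁ u)             = π₁ (substP ρ u)
substP ρ (t · u)            = substP ρ t · substP ρ u
substP ρ (ƛ A u)            = ƛ A (substP (extP ρ) u)
substP ρ (ι₀ A B u)         = ι₀ A B (substP ρ u)
substP ρ (ι₁ A B u)         = ι₁ A B (substP ρ u)
substP ρ (case u A w₁ B w₂) =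
  case (substP ρ u) A (substP (extP ρ) w₁) B (substP (extP ρ) w₂)
substP ρ (u ·ₜ m)           = substP ρ u ·ₜ m
substP ρ (Λ u)              = Λ (substP (extPT ρ) u)
substP ρ (pack m A u)       = pack m A (substP ρ u)
substP ρ (unpack u A t)     = unpack (substP ρ u) A (substP (extP (extPT ρ)) t)
substP ρ (par A B u v)      = par A B (substP (extP ρ) u) (substP (extP ρ) v)
substP ρ (efq P u)          = efq P (substP ρ u)
substP ρ (abort A B)        = abort A B

sub0 : Pf → PSub
sub0 t zero    = inj₁ t
sub0 t (suc i) = inj₂ i

_[_/0] : Pf → Pf → Pf
u [ t /0] = substP (sub0 t) u

_[_/α] : Pf → Tm → Pf
u [ m /α] = substPT (inst m) u

data Comp : Set where
  arg  : Pf → Comp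
  targ : Tm → Comp
  fst  : Comp
  snd  : Comp
  cs   : Fm → Pf → Fm → Pf → Comp
  un   : Fm → Pf → Comp

Stack : Set
Stack = List Comp

infixl 5 _·c_ _·s_
_·c_ : Pf → Comp → Pf
t ·c arg u          = t · u
t ·c targ m         = t ·ₜ m
t ·c fst            = π₀ t
t ·c snd            = π₁ t
t ·c cs A w₁ B w₂   = case t A w₁ B w₂
t ·c un A w         = unpack t A w

_·s_ : Pf → Stack → Pf
t ·s []      = t
t ·s (c ∷ σ) = (t ·c c) ·s σ

-- weakening of a stack component by one proof variable (the bound a)
wkC : Comp → Comp
wkC (arg u)        = arg (renP suc u)
wkC (targ m)       = targ m
wkC fst            = fst
wkC snd            = snd
wkC (cs A w₁ B w₂) = cs A (renP (extR suc) w₁) B (renP (extR suc) w₂)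
wkC (un A w)       = un A (renP (extR suc) w)

data HeadStep : Pf → Pf → Set where
  βλ   : ∀ A u v σ → HeadStep (ƛ A u ·s (arg v ∷ σ)) ((u [ v /0]) ·s σ)
  βΛ   : ∀ u m σ → HeadStep (Λ u ·s (targ m ∷ σ)) ((u [ m /α]) ·s σ)
  βπ₀  : ∀ u v σ → HeadStep (⟨ u , v ⟩ ·s (fst ∷ σ)) (u ·s σ)
  βπ₁  : ∀ u v σ → HeadStep (⟨ u , v ⟩ ·s (snd ∷ σ)) (v ·s σ)
  βι₀  : ∀ A B u A′ t₀ B′ t₁ σ →
         HeadStep (ι₀ A B u ·s (cs A′ t₀ B′ t₁ ∷ σ)) ((t₀ [ u /0]) ·s σ)
  βι₁  : ∀ A B u A′ t₀ B′ t₁ σ →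
         HeadStep (ι₁ A B u ·s (cs A′ t₀ B′ t₁ ∷ σ)) ((t₁ [ u /0]) ·s σ)
  β∃   : ∀ m A u A′ v σ →
         HeadStep (pack m A u ·s (un A′ v ∷ σ)) (((v [ m /α]) [ u /0]) ·s σ)
  βpar : ∀ A B u v ξ σ →
         HeadStep (par A B u v ·s (ξ ∷ σ)) (par A B (u ·c wkC ξ) (v ·c wkC ξ) ·s σ)
  βabort : ∀ A B u σ → typeOf u ≡ typeOf (abort A B ·s (arg u ∷ σ)) →
           HeadStep (abort A B ·s (arg u ∷ σ)) u

HeadRedex : Pf → Set
HeadRedex t = ∃[ t′ ] HeadStep t t′

Elementary : Pf → Set
Elementary (par A B u v) = ⊥
Elementary _             = ⊤

data PCtx : Set where
  hole  : PCtx
  left  : Fm → Fm → PCtx → Pf → PCtx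
  right : Fm → Fm → Pf → PCtx → PCtx

plug : PCtx → Pf → Pf
plug hole          t = t
plug (left A B C v)  t = par A B (plug C t) v
plug (right A B u C) t = par A B u (plug C t)

depth : PCtx → ℕ
depth hole            = zero
depth (left A B C v)  = suc (depth C)
depth (right A B u C) = suc (depth C)

_⊕_ : PCtx → PCtx → PCtx
hole            ⊕ D = D
left A B C v    ⊕ D = left A B (C ⊕ D) v
right A B u C   ⊕ D = right A B u (C ⊕ D)

-- an elementary process at ∥-depth d is the starting point of a Dummett
-- redex: it has the form a u ρ with a bound by one of the enclosing ∥'s
DummettActive : ℕ → Pf → Set
DummettActive d t = ∃[ k ] ∃[ X ] ∃[ u ] ∃[ ρ ] (t ≡ pv k X ·s (arg u ∷ ρ) × k < d)

Inactive : ℕ → Pf → Set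
Inactive d t = ¬ HeadRedex t × ¬ DummettActive d t

AllInactive : ℕ → Pf → Set
AllInactive d (par A B u v) = AllInactive (suc d) u × AllInactive (suc d) v
AllInactive d t             = Inactive d t

LeftInactive : ℕ → PCtx → Set
LeftInactive d hole            = ⊤
LeftInactive d (left A B C v)  = LeftInactive (suc d) C
LeftInactive d (right A B u C) = AllInactive (suc d) u × LeftInactive (suc d) C

-- v[λy^B u / a^{B→A}], where v lives under the binder a (index 0) and the
-- result is placed k further ∥-binders below a.
dsub : ℕ → Fm → Pf → Pf → Pf
dsub k B u v = substP ρ v
  where
  ρ : PSub
  ρ zero    = inj₁ (ƛ B (renP suc u))
  ρ (suc i) = inj₂ (suc (k + i))

-- Head reduction t ≻ t′: contract the head redex whose starting symbol is
-- leftmost.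

infix 3 _≻_
data _≻_ : Pf → Pf → Set where
  elem : ∀ C e e′ → LeftInactive zero C → HeadStep e e′ →
         plug C e ≻ plug C e′
  dumL : ∀ C₁ A B C₂ v X u σ →
         LeftInactive zero (C₁ ⊕ left A B C₂ v) →
         plug C₁ (par A B (plug C₂ (pv (depth C₂) X ·s (arg u ∷ σ))) v)
         ≻ plug C₁ (par A B (plug C₂ (dsub (depth C₂) B u v)) v)
  dumR : ∀ C₁ A B v C₂ X u σ →
         LeftInactive zero (C₁ ⊕ right A B v C₂) →
         plug C₁ (par A B v (plug C₂ (pv (depth C₂) X ·s (arg u ∷ σ))))
         ≻ plug C₁ (par A B v (plug C₂ (dsub (depth C₂) A u v)))

HeadNormal : Pf → Set
HeadNormal t = ∀ t′ → ¬ (t ≻ t′)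

data Value : Pf → Set where
  vλ     : ∀ A u → Value (ƛ A u)
  vΛ     : ∀ u → Value (Λ u)
  vpair  : ∀ u t → Value ⟨ u , t ⟩
  vι₀    : ∀ A B u → Value (ι₀ A B u)
  vι₁    : ∀ A B u → Value (ι₁ A B u)
  vpack  : ∀ m A u → Value (pack m A u)
  vefq   : ∀ P u → Value (efq P u)
  vabort : ∀ A B → Value (abort A B)

module Submission where

-- Since head reduction contracts the leftmost head redex, head normality of
-- t makes every elementary process of t inactive: it starts no head redex,
-- and if its head is one of the enclosing ∥-variables aⱼ then it is not
-- applied (aⱼ u ρ would start a Dummett reduction).  Showing this for a
-- given process requires it for all processes to its left, so the ∥-tree is
-- walked from left to right.  Typing then pins down an inactive process h σ:
-- an introduction form or a ∥ followed by a component is a redex, efq is of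
-- atomic type and cannot be eliminated, the aⱼ have implication types so only
-- an argument can follow them, and 𝒜 u σ is a redex when u has its type.

open import Defs
open import Data.Nat using (ℕ; zero; suc; _+_; _<_; _≤_; s≤s; _≤?_)
open import Data.Nat.Properties using (+-suc; +-identityʳ; ≰⇒>; m≤n⇒m<n∨m≡n)
open import Data.List using (List; []; _∷_; _++_)
open import Data.Sum using (_⊎_; inj₁; inj₂)
open import Data.Product using (_×_; ∃-syntax; _,_; proj₁; proj₂)
open import Data.Unit using (tt)
open import Data.Empty using (⊥-elim)
open import Relation.Nullary using (¬_; yes; no)
open import Relation.Binary.PropositionalEquality
  using (_≡_; _≢_; refl; sym; trans; cong; subst)

plug-⊕ : ∀ D E u → plug (D ⊕ E) u ≡ plug D (plug E u)
plug-⊕ hole            E u = refl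
plug-⊕ (left A B D v)  E u = cong (λ w → par A B w v) (plug-⊕ D E u)
plug-⊕ (right A B w D) E u = cong (par A B w) (plug-⊕ D E u)

depth-⊕ : ∀ D E → depth (D ⊕ E) ≡ depth E + depth D
depth-⊕ hole            E = sym (+-identityʳ (depth E))
depth-⊕ (left A B D v)  E = trans (cong suc (depth-⊕ D E)) (sym (+-suc (depth E) (depth D)))
depth-⊕ (right A B u D) E = trans (cong suc (depth-⊕ D E)) (sym (+-suc (depth E) (depth D)))

LeftInactive-⊕ : ∀ {d} D {E} → LeftInactive d D → LeftInactive (d + depth D) E →
                 LeftInactive d (D ⊕ E)
LeftInactive-⊕ {d} hole {E} _ liE = subst (λ n → LeftInactive n E) (+-identityʳ d) liE
LeftInactive-⊕ {d} (left A B D v) {E} liD liE =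
  LeftInactive-⊕ D liD (subst (λ n → LeftInactive n E) (+-suc d (depth D)) liE)
LeftInactive-⊕ {d} (right A B u D) {E} (inactive-u , liD) liE =
  inactive-u , LeftInactive-⊕ D liD (subst (λ n → LeftInactive n E) (+-suc d (depth D)) liE)

data BinderAt : PCtx → ℕ → Set where
  binderˡ : ∀ C₁ A B C₂ v → BinderAt (C₁ ⊕ left A B C₂ v) (depth C₂)
  binderʳ : ∀ C₁ A B v C₂ → BinderAt (C₁ ⊕ right A B v C₂) (depth C₂)

binderAt : ∀ D {k} → k < depth D → BinderAt D k
binderAt (left A B C v) {k} (s≤s k≤d) with m≤n⇒m<n∨m≡n k≤d
... | inj₂ refl = binderˡ hole A B C v
... | inj₁ k<d with binderAt C k<d
...   | binderˡ C₁ A′ B′ C₂ v′ = binderˡ (left A B C₁ v) A′ B′ C₂ v′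
...   | binderʳ C₁ A′ B′ v′ C₂ = binderʳ (left A B C₁ v) A′ B′ v′ C₂
binderAt (right A B u C) {k} (s≤s k≤d) with m≤n⇒m<n∨m≡n k≤d
... | inj₂ refl = binderʳ hole A B u C
... | inj₁ k<d with binderAt C k<d
...   | binderˡ C₁ A′ B′ C₂ v′ = binderˡ (right A B u C₁) A′ B′ C₂ v′
...   | binderʳ C₁ A′ B′ v′ C₂ = binderʳ (right A B u C₁) A′ B′ v′ C₂

HeadNormal-⊕ : ∀ D E u → HeadNormal (plug D (plug E u)) → HeadNormal (plug (D ⊕ E) u)
HeadNormal-⊕ D E u = subst HeadNormal (sym (plug-⊕ D E u))

headNormal⇒inactive : ∀ D e → LeftInactive zero D → HeadNormal (plug D e) →
                      Inactive (depth D) e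
proj₁ (headNormal⇒inactive D e li hn) (e′ , step) = hn _ (elem D e e′ li step)
proj₂ (headNormal⇒inactive D e li hn) (k , X , u , ρ , refl , k<d) with binderAt D k<d
... | binderˡ C₁ A B C₂ v =
  hn _ (subst (_≻ _) (sym (plug-⊕ C₁ _ _)) (dumL C₁ A B C₂ v X u ρ li))
... | binderʳ C₁ A B v C₂ =
  hn _ (subst (_≻ _) (sym (plug-⊕ C₁ _ _)) (dumR C₁ A B v C₂ X u ρ li))

headNormal⇒allInactive : ∀ D u → LeftInactive zero D → HeadNormal (plug D u) →
                         AllInactive (depth D) u
headNormal⇒allInactive D (par A B u v) li hn = inactive-u , inactive-v
  where
  inactive-u : AllInactive (suc (depth D)) u
  inactive-u = subst (λ n → AllInactive n u) (depth-⊕ D (left A B hole v))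
    (headNormal⇒allInactive (D ⊕ left A B hole v) u (LeftInactive-⊕ D li tt)
      (HeadNormal-⊕ D (left A B hole v) u hn))
  inactive-v : AllInactive (suc (depth D)) v
  inactive-v = subst (λ n → AllInactive n v) (depth-⊕ D (right A B u hole))
    (headNormal⇒allInactive (D ⊕ right A B u hole) v (LeftInactive-⊕ D li (inactive-u , tt))
      (HeadNormal-⊕ D (right A B u hole) v hn))
headNormal⇒allInactive D e@(pv _ _)          li hn = headNormal⇒inactive D e li hn
headNormal⇒allInactive D e@(⟨_,_⟩ _ _)       li hn = headNormal⇒inactive D e li hn
headNormal⇒allInactive D e@(π₀ _)            li hn = headNormal⇒inactive D e li hn
headNormal⇒allInactive D e@(π₁ _)            li hn = headNormal⇒inactive D e li hn
headNormal⇒allInactive D e@(_ · _)           li hn = headNormal⇒inactive D e li hn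
headNormal⇒allInactive D e@(ƛ _ _)           li hn = headNormal⇒inactive D e li hn
headNormal⇒allInactive D e@(ι₀ _ _ _)        li hn = headNormal⇒inactive D e li hn
headNormal⇒allInactive D e@(ι₁ _ _ _)        li hn = headNormal⇒inactive D e li hn
headNormal⇒allInactive D e@(case _ _ _ _ _)  li hn = headNormal⇒inactive D e li hn
headNormal⇒allInactive D e@(_ ·ₜ _)          li hn = headNormal⇒inactive D e li hn
headNormal⇒allInactive D e@(Λ _)             li hn = headNormal⇒inactive D e li hn
headNormal⇒allInactive D e@(pack _ _ _)      li hn = headNormal⇒inactive D e li hn
headNormal⇒allInactive D e@(unpack _ _ _)    li hn = headNormal⇒inactive D e li hn
headNormal⇒allInactive D e@(efq _ _)         li hn = headNormal⇒inactive D e li hn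
headNormal⇒allInactive D e@(abort _ _)       li hn = headNormal⇒inactive D e li hn

headNormal⇒leftInactive : ∀ D C e → LeftInactive zero D → HeadNormal (plug D (plug C e)) →
                          LeftInactive (depth D) C
headNormal⇒leftInactive D hole e li hn = tt
headNormal⇒leftInactive D (left A B C v) e li hn =
  subst (λ n → LeftInactive n C) (depth-⊕ D (left A B hole v))
    (headNormal⇒leftInactive (D ⊕ left A B hole v) C e (LeftInactive-⊕ D li tt)
      (HeadNormal-⊕ D (left A B hole v) (plug C e) hn))
headNormal⇒leftInactive D (right A B u C) e li hn =
  inactive-u ,
  subst (λ n → LeftInactive n C) (depth-⊕ D (right A B u hole))
    (headNormal⇒leftInactive (D ⊕ right A B u hole) C e (LeftInactive-⊕ D li (inactive-u , tt))
      (HeadNormal-⊕ D (right A B u hole) (plug C e) hn))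
  where
  inactive-u : AllInactive (suc (depth D)) u
  inactive-u = subst (λ n → AllInactive n u) (depth-⊕ D (left A B hole (plug C e)))
    (headNormal⇒allInactive (D ⊕ left A B hole (plug C e)) u (LeftInactive-⊕ D li tt)
      (HeadNormal-⊕ D (left A B hole (plug C e)) u hn))

data IsImplication : Fm → Set where
  implication : ∀ A B → IsImplication (A ⇒ B)

ImplicationPrefix : ℕ → List Fm → Set
ImplicationPrefix n Δ = ∀ {k X} → k < n → Δ ∋ k ∶ X → IsImplication X

ImplicationPrefix-∷ : ∀ {n Δ A B} → ImplicationPrefix n Δ →
                      ImplicationPrefix (suc n) ((A ⇒ B) ∷ Δ)
ImplicationPrefix-∷ prefix {zero}  _         here      = implication _ _
ImplicationPrefix-∷ prefix {suc k} (s≤s k<n) (there x) = prefix k<n x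

⊢-plug⁻¹ : ∀ C {Γ T e n} → ImplicationPrefix n Γ → Γ ⊢ plug C e ∶ T →
           ∃[ Δ ] ∃[ T′ ] (Δ ⊢ e ∶ T′ × ImplicationPrefix (n + depth C) Δ)
⊢-plug⁻¹ hole {n = n} prefix d =
  _ , _ , d , subst (λ m → ImplicationPrefix m _) (sym (+-identityʳ n)) prefix
⊢-plug⁻¹ (left A B C v) {n = n} prefix (⊢par du _) with ⊢-plug⁻¹ C (ImplicationPrefix-∷ prefix) du
... | Δ , T′ , de , prefix′ = Δ , T′ , de , subst (λ m → ImplicationPrefix m Δ) (sym (+-suc n (depth C))) prefix′
⊢-plug⁻¹ (right A B u C) {n = n} prefix (⊢par _ dv) with ⊢-plug⁻¹ C (ImplicationPrefix-∷ prefix) dv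
... | Δ , T′ , de , prefix′ = Δ , T′ , de , subst (λ m → ImplicationPrefix m Δ) (sym (+-suc n (depth C))) prefix′

⊢-·c⁻¹ : ∀ {Δ T} t c → Δ ⊢ t ·c c ∶ T → ∃[ T′ ] (Δ ⊢ t ∶ T′)
⊢-·c⁻¹ t (arg u)        (⊢app d _)    = _ , d
⊢-·c⁻¹ t (targ m)       (⊢appT _ d)   = _ , d
⊢-·c⁻¹ t fst            (⊢π₀ d)       = _ , d
⊢-·c⁻¹ t snd            (⊢π₁ d)       = _ , d
⊢-·c⁻¹ t (cs A w₁ B w₂) (⊢case d _ _) = _ , d
⊢-·c⁻¹ t (un A w)       (⊢unpack d _) = _ , d

⊢-·s⁻¹ : ∀ {Δ T} t σ → Δ ⊢ t ·s σ ∶ T → ∃[ T′ ] (Δ ⊢ t ∶ T′)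
⊢-·s⁻¹ t []      d = _ , d
⊢-·s⁻¹ t (c ∷ σ) d = ⊢-·c⁻¹ t c (proj₂ (⊢-·s⁻¹ (t ·c c) σ d))

data IsArg : Comp → Set where
  isArg : ∀ u → IsArg (arg u)

implication-·c-isArg : ∀ {Δ T t} c → (∀ {A} → Δ ⊢ t ∶ A → IsImplication A) →
                       Δ ⊢ t ·c c ∶ T → IsArg c
implication-·c-isArg (arg u)        _   _             = isArg u
implication-·c-isArg (targ m)       imp (⊢appT _ d)   with () ← imp d
implication-·c-isArg fst            imp (⊢π₀ d)       with () ← imp d
implication-·c-isArg snd            imp (⊢π₁ d)       with () ← imp d
implication-·c-isArg (cs _ _ _ _)   imp (⊢case d _ _) with () ← imp d
implication-·c-isArg (un _ _)       imp (⊢unpack d _) with () ← imp d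

efq-·c-untypable : ∀ {Δ T P u} c → ¬ (Δ ⊢ efq P u ·c c ∶ T)
efq-·c-untypable (arg w)      (⊢app (⊢efq () _) _)
efq-·c-untypable (targ m)     (⊢appT _ (⊢efq () _))
efq-·c-untypable fst          (⊢π₀ (⊢efq () _))
efq-·c-untypable snd          (⊢π₁ (⊢efq () _))
efq-·c-untypable (cs _ _ _ _) (⊢case (⊢efq () _) _ _)
efq-·c-untypable (un _ _)     (⊢unpack (⊢efq () _) _)

data Intro : Pf → Set where
  λ-intro    : ∀ A u → Intro (ƛ A u)
  Λ-intro    : ∀ u → Intro (Λ u)
  pair-intro : ∀ u t → Intro ⟨ u , t ⟩
  ι₀-intro   : ∀ A B u → Intro (ι₀ A B u)
  ι₁-intro   : ∀ A B u → Intro (ι₁ A B u)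
  pack-intro : ∀ m A u → Intro (pack m A u)

intro-value : ∀ {h} → Intro h → Value h
intro-value (λ-intro A u)      = vλ A u
intro-value (Λ-intro u)        = vΛ u
intro-value (pair-intro u t)   = vpair u t
intro-value (ι₀-intro A B u)   = vι₀ A B u
intro-value (ι₁-intro A B u)   = vι₁ A B u
intro-value (pack-intro m A u) = vpack m A u

intro-·c-redex : ∀ {Δ T h} c ρ → Intro h → Δ ⊢ h ·c c ∶ T → HeadRedex (h ·s (c ∷ ρ))
intro-·c-redex (arg w)          ρ (λ-intro A u)      _              = _ , βλ A u w ρ
intro-·c-redex (targ m)         ρ (λ-intro A u)      (⊢appT _ ())
intro-·c-redex fst              ρ (λ-intro A u)      (⊢π₀ ())
intro-·c-redex snd              ρ (λ-intro A u)      (⊢π₁ ())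
intro-·c-redex (cs _ _ _ _)     ρ (λ-intro A u)      (⊢case () _ _)
intro-·c-redex (un _ _)         ρ (λ-intro A u)      (⊢unpack () _)
intro-·c-redex (arg w)          ρ (Λ-intro u)        (⊢app () _)
intro-·c-redex (targ m)         ρ (Λ-intro u)        _              = _ , βΛ u m ρ
intro-·c-redex fst              ρ (Λ-intro u)        (⊢π₀ ())
intro-·c-redex snd              ρ (Λ-intro u)        (⊢π₁ ())
intro-·c-redex (cs _ _ _ _)     ρ (Λ-intro u)        (⊢case () _ _)
intro-·c-redex (un _ _)         ρ (Λ-intro u)        (⊢unpack () _)
intro-·c-redex (arg w)          ρ (pair-intro u t)   (⊢app () _)
intro-·c-redex (targ m)         ρ (pair-intro u t)   (⊢appT _ ())
intro-·c-redex fst              ρ (pair-intro u t)   _              = _ , βπ₀ u t ρ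
intro-·c-redex snd              ρ (pair-intro u t)   _              = _ , βπ₁ u t ρ
intro-·c-redex (cs _ _ _ _)     ρ (pair-intro u t)   (⊢case () _ _)
intro-·c-redex (un _ _)         ρ (pair-intro u t)   (⊢unpack () _)
intro-·c-redex (arg w)          ρ (ι₀-intro A B u)   (⊢app () _)
intro-·c-redex (targ m)         ρ (ι₀-intro A B u)   (⊢appT _ ())
intro-·c-redex fst              ρ (ι₀-intro A B u)   (⊢π₀ ())
intro-·c-redex snd              ρ (ι₀-intro A B u)   (⊢π₁ ())
intro-·c-redex (cs A′ t₀ B′ t₁) ρ (ι₀-intro A B u)   _              = _ , βι₀ A B u A′ t₀ B′ t₁ ρ
intro-·c-redex (un _ _)         ρ (ι₀-intro A B u)   (⊢unpack () _)
intro-·c-redex (arg w)          ρ (ι₁-intro A B u)   (⊢app () _)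
intro-·c-redex (targ m)         ρ (ι₁-intro A B u)   (⊢appT _ ())
intro-·c-redex fst              ρ (ι₁-intro A B u)   (⊢π₀ ())
intro-·c-redex snd              ρ (ι₁-intro A B u)   (⊢π₁ ())
intro-·c-redex (cs A′ t₀ B′ t₁) ρ (ι₁-intro A B u)   _              = _ , βι₁ A B u A′ t₀ B′ t₁ ρ
intro-·c-redex (un _ _)         ρ (ι₁-intro A B u)   (⊢unpack () _)
intro-·c-redex (arg w)          ρ (pack-intro m A u) (⊢app () _)
intro-·c-redex (targ m′)        ρ (pack-intro m A u) (⊢appT _ ())
intro-·c-redex fst              ρ (pack-intro m A u) (⊢π₀ ())
intro-·c-redex snd              ρ (pack-intro m A u) (⊢π₁ ())
intro-·c-redex (cs _ _ _ _)     ρ (pack-intro m A u) (⊢case () _ _)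
intro-·c-redex (un A′ v)        ρ (pack-intro m A u) _              = _ , β∃ m A u A′ v ρ

data Head : Pf → Set where
  var-head   : ∀ k X → Head (pv k X)
  abort-head : ∀ A B → Head (abort A B)
  efq-head   : ∀ P u → Head (efq P u)
  par-head   : ∀ A B u v → Head (par A B u v)
  intro-head : ∀ {h} → Intro h → Head h

data Spine : Pf → Set where
  spine : ∀ h σ → Head h → Spine (h ·s σ)

·s-++ : ∀ t σ c → t ·s (σ ++ c ∷ []) ≡ (t ·s σ) ·c c
·s-++ t []      c = refl
·s-++ t (d ∷ σ) c = ·s-++ (t ·c d) σ c

Spine-·c : ∀ {e} c → Spine e → Spine (e ·c c)
Spine-·c c (spine h σ hd) = subst Spine (·s-++ h σ c) (spine h (σ ++ c ∷ []) hd)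

spineOf : ∀ e → Spine e
spineOf (pv k X)             = spine _ [] (var-head k X)
spineOf ⟨ u , t ⟩            = spine _ [] (intro-head (pair-intro u t))
spineOf (π₀ e)               = Spine-·c fst (spineOf e)
spineOf (π₁ e)               = Spine-·c snd (spineOf e)
spineOf (e · u)              = Spine-·c (arg u) (spineOf e)
spineOf (ƛ A u)              = spine _ [] (intro-head (λ-intro A u))
spineOf (ι₀ A B u)           = spine _ [] (intro-head (ι₀-intro A B u))
spineOf (ι₁ A B u)           = spine _ [] (intro-head (ι₁-intro A B u))
spineOf (case e A w₁ B w₂)   = Spine-·c (cs A w₁ B w₂) (spineOf e)
spineOf (e ·ₜ m)             = Spine-·c (targ m) (spineOf e)
spineOf (Λ u)                = spine _ [] (intro-head (Λ-intro u))
spineOf (pack m A u)         = spine _ [] (intro-head (pack-intro m A u))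
spineOf (unpack e A w)       = Spine-·c (un A w) (spineOf e)
spineOf (par A B u v)        = spine _ [] (par-head A B u v)
spineOf (efq P u)            = spine _ [] (efq-head P u)
spineOf (abort A B)          = spine _ [] (abort-head A B)

-- The proof variables of index < n are the ∥-variables a₁ … aₙ enclosing e.
ProcessShape : ℕ → Pf → Set
ProcessShape n e = ∃[ σ ] ((∃[ k ] ∃[ X ] (e ≡ pv k X ·s σ × n ≤ k))
  ⊎ (∃[ A ] ∃[ B ] ∃[ u ] (e ≡ abort A B ·s (arg u ∷ σ) × typeOf u ≢ typeOf e))
  ⊎ (∃[ k ] ∃[ X ] (e ≡ pv k X × k < n))
  ⊎ Value e)

spine-shape : ∀ {Δ T n} h σ → Head h → ImplicationPrefix n Δ → Δ ⊢ h ·s σ ∶ T →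
              Inactive n (h ·s σ) → Elementary (h ·s σ) → ProcessShape n (h ·s σ)
spine-shape {n = n} _ σ (var-head k X) _ _ _ _ with n ≤? k
... | yes n≤k = σ , inj₁ (k , X , refl , n≤k)
spine-shape _ [] (var-head k X) _ _ _ _ | no n≰k =
  [] , inj₂ (inj₂ (inj₁ (k , X , refl , ≰⇒> n≰k)))
spine-shape _ (c ∷ ρ) (var-head k X) prefix d inactive _ | no n≰k
  with isArg u ← implication-·c-isArg c (λ { (⊢var x) → prefix (≰⇒> n≰k) x })
                   (proj₂ (⊢-·s⁻¹ (pv k X ·c c) ρ d))
  = ⊥-elim (proj₂ inactive (k , X , u , ρ , refl , ≰⇒> n≰k))
spine-shape _ [] (abort-head A B) _ _ _ _ = [] , inj₂ (inj₂ (inj₂ (vabort A B)))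
spine-shape _ (c ∷ ρ) (abort-head A B) _ d inactive _
  with isArg u ← implication-·c-isArg c (λ { ⊢abort → implication A B })
                   (proj₂ (⊢-·s⁻¹ (abort A B ·c c) ρ d))
  = ρ , inj₂ (inj₁ (A , B , u , refl , λ same-type → proj₁ inactive (u , βabort A B u ρ same-type)))
spine-shape _ [] (efq-head P u) _ _ _ _ = [] , inj₂ (inj₂ (inj₂ (vefq P u)))
spine-shape _ (c ∷ ρ) (efq-head P u) _ d _ _ =
  ⊥-elim (efq-·c-untypable c (proj₂ (⊢-·s⁻¹ (efq P u ·c c) ρ d)))
spine-shape _ [] (par-head A B u v) _ _ _ ()
spine-shape _ (c ∷ ρ) (par-head A B u v) _ _ inactive _ =
  ⊥-elim (proj₁ inactive (_ , βpar A B u v c ρ))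
spine-shape _ [] (intro-head i) _ _ _ _ = [] , inj₂ (inj₂ (inj₂ (intro-value i)))
spine-shape h (c ∷ ρ) (intro-head i) _ d inactive _ =
  ⊥-elim (proj₁ inactive (intro-·c-redex c ρ i (proj₂ (⊢-·s⁻¹ (h ·c c) ρ d))))

inactive-shape : ∀ {Δ T n} e → ImplicationPrefix n Δ → Δ ⊢ e ∶ T →
                 Inactive n e → Elementary e → ProcessShape n e
inactive-shape e prefix d with spineOf e
... | spine h σ hd = spine-shape h σ hd prefix d

proposition3p2 : (Γ : List Fm) (T : Fm) (t : Pf) → Γ ⊢ t ∶ T → HeadNormal t →
    (C : PCtx) (e : Pf) → t ≡ plug C e → Elementary e →
    ∃[ σ ] ((∃[ k ] ∃[ X ] (e ≡ pv k X ·s σ × depth C ≤ k))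
      ⊎ (∃[ A ] ∃[ B ] ∃[ u ] (e ≡ abort A B ·s (arg u ∷ σ) × typeOf u ≢ typeOf e))
      ⊎ (∃[ k ] ∃[ X ] (e ≡ pv k X × k < depth C))
      ⊎ Value e)
proposition3p2 Γ T t d hn C e refl
  with Δ , T′ , de , prefix ← ⊢-plug⁻¹ C {n = zero} (λ ()) d =
  inactive-shape e prefix de
    (headNormal⇒inactive C e (headNormal⇒leftInactive hole C e tt hn) hn)
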